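{- For all $k\geq2$, the complete graph $K_{2k+1}$ has a good drawing in which any given vertex $v$ is a fan.
   Context: Fix $k\geq 2$ and let $I:=\{i,-i:1\leq i\leq k\}$. A $2k$-tree is either $K_{2k+1}$ or a graph with a $2k$-simplicial vertex $v$ (one whose neighbourhood is a $2k$-clique) such that $G\setminus v$ is a $2k$-tree. A geometric drawing maps vertices injectively to points of the plane and draws each edge as a straight segment; it is in general position if no three vertices are collinear. A drawing has thickness $k$ if its edges can be coloured $1,\dots,k$ so that edges of the same colour do not cross. For a vertex $v$ of degree $2k$ with neighbours labelled $(u_1,\dots,u_k,u_{ -1},\dots,u_{ -k})$ in clockwise order around $v$, let $R(v)$ be the set of $4k$ open rays from $v$ through each neighbour together with their opposite open rays, in clockwise order around $v$. $v$ is balanced if, for each $i\in I$, the ray from $v$ through $u_i$ and the ray opposite to the ray from $v$ through $u_{ -i}$ are consecutive in $R(v)$. Given an edge colouring with colours $1,\dots,k$ in which same-coloured edges do not cross, a $2k$-simplicial vertex $v$ is a fan if, for some such labelling of its neighbours, $v$ is balanced and each edge $vu_i$ has colour $|i|$. A drawing of a $2k$-tree $G$ is good if it is a general position geometric drawing of thickness $k$ such that at least one vertex is a fan when $G\simeq K_{2k+1}$, and every $2k$-simplicial vertex is a fan when $G\not\simeq K_{2k+1}$. -}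

module Defs where

open import Data.Nat using (ℕ; suc; zero)
import Data.Nat as ℕ
open import Data.Fin using (Fin; toℕ; _↑ˡ_; _↑ʳ_)
open import Data.Rational using (ℚ; 0ℚ; 1ℚ; _+_; _-_; _*_; -_; _<_; _>_; _≤_)
open import Data.Product using (_×_; _,_; proj₁; proj₂; ∃; ∃-syntax; Σ)
open import Data.Sum using (_⊎_)
open import Relation.Nullary using (¬_)
open import Relation.Binary.PropositionalEquality using (_≡_; _≢_)

Point : Set
Point = ℚ × ℚ

_⊖_ : Point → Point → Point
(a , b) ⊖ (c , d) = (a - c , b - d)

neg : Point → Point
neg (a , b) = (- a , - b)

along : Point → Point → ℚ → Point
along (px , py) (qx , qy) t = (px + t * (qx - px) , py + t * (qy - py))

-- 2D cross product  a.x b.y - a.y b.x  (> 0 : b is counterclockwise of a)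
cr : Point → Point → ℚ
cr (ax , ay) (bx , by) = ax * by - ay * bx

dot : Point → Point → ℚ
dot (ax , ay) (bx , by) = ax * bx + ay * by

Collinear : Point → Point → Point → Set
Collinear a b c = cr (b ⊖ a) (c ⊖ a) ≡ 0ℚ

Cross : Point → Point → Point → Point → Set
Cross p q r s = ∃[ t ] ∃[ u ] (0ℚ < t × t < 1ℚ × 0ℚ < u × u < 1ℚ × along p q t ≡ along r s u)

-- Direction d lies strictly between directions a and b when turning
-- clockwise from a to b (directions are nonzero vectors up to positive
-- scaling).
CWBetween : Point → Point → Point → Set
CWBetween a d b =
    (cr a b < 0ℚ × cr a d < 0ℚ × cr d b < 0ℚ)
  ⊎ (cr a b > 0ℚ × (cr b d > 0ℚ ⊎ cr d a > 0ℚ))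
  ⊎ (cr a b ≡ 0ℚ × dot a b < 0ℚ × cr a d < 0ℚ)
  ⊎ (cr a b ≡ 0ℚ × dot a b > 0ℚ × (cr a d ≢ 0ℚ ⊎ dot a d < 0ℚ))

NextCW : (Point → Set) → Point → Point → Set
NextCW S a b = ∀ d → S d → ¬ CWBetween a d b

Consecutive : (Point → Set) → Point → Point → Set
Consecutive S a b = NextCW S a b ⊎ NextCW S b a

module _ (k : ℕ) where

  V : Set
  V = Fin (suc (k ℕ.+ k))

  Drawing : Set
  Drawing = V → Point

  -- edge colouring with colours 1..k, colour j represented by (j-1) : Fin k
  Colouring : Set
  Colouring = V → V → Fin k

  GeneralPosition : Drawing → Set
  GeneralPosition pos =
      (∀ a b → pos a ≡ pos b → a ≡ b)
    × (∀ a b c → a ≢ b → a ≢ c → b ≢ c → ¬ Collinear (pos a) (pos b) (pos c))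

  NonCrossingColouring : Drawing → Colouring → Set
  NonCrossingColouring pos col =
      (∀ a b → col a b ≡ col b a)
    × (∀ a b c d → a ≢ b → c ≢ d → ¬ (a ≡ c × b ≡ d) → ¬ (a ≡ d × b ≡ c)
         → col a b ≡ col c d → ¬ Cross (pos a) (pos b) (pos c) (pos d))

  dir : Drawing → V → V → Point
  dir pos v u = pos u ⊖ pos v

  NbrRays : Drawing → V → Point → Set
  NbrRays pos v d = ∃[ u ] (u ≢ v × d ≡ dir pos v u)

  R : Drawing → V → Point → Set
  R pos v d = ∃[ u ] (u ≢ v × (d ≡ dir pos v u ⊎ d ≡ neg (dir pos v u)))

  CyclicSucc : Fin (k ℕ.+ k) → Fin (k ℕ.+ k) → Set
  CyclicSucc j j' = (toℕ j' ≡ suc (toℕ j)) ⊎ (suc (toℕ j) ≡ k ℕ.+ k × toℕ j' ≡ 0)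

  -- A labelling w of the neighbours of v: w (i ↑ˡ k) = u_{i+1},
  -- w (k ↑ʳ i) = u_{-(i+1)}, so w lists (u_1,…,u_k,u_{-1},…,u_{-k}).
  Labelling : V → (Fin (k ℕ.+ k) → V) → Set
  Labelling v w =
      (∀ j j' → w j ≡ w j' → j ≡ j')
    × (∀ j → w j ≢ v)
    × (∀ u → u ≢ v → ∃[ j ] w j ≡ u)

  ClockwiseLabelling : Drawing → V → (Fin (k ℕ.+ k) → V) → Set
  ClockwiseLabelling pos v w =
    ∀ j j' → CyclicSucc j j' → NextCW (NbrRays pos v) (dir pos v (w j)) (dir pos v (w j'))

  Balanced : Drawing → V → (Fin (k ℕ.+ k) → V) → Set
  Balanced pos v w =
      (∀ (i : Fin k) → Consecutive (R pos v) (dir pos v (w (i ↑ˡ k))) (neg (dir pos v (w (k ↑ʳ i)))))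
    × (∀ (i : Fin k) → Consecutive (R pos v) (dir pos v (w (k ↑ʳ i))) (neg (dir pos v (w (i ↑ˡ k)))))

  -- In K_{2k+1} every vertex is 2k-simplicial.
  Fan : Drawing → Colouring → V → Set
  Fan pos col v = ∃[ w ]
      ( Labelling v w
      × ClockwiseLabelling pos v w
      × Balanced pos v w
      × (∀ (i : Fin k) → col v (w (i ↑ˡ k)) ≡ i)
      × (∀ (i : Fin k) → col v (w (k ↑ʳ i)) ≡ i))

  Good : Drawing → Colouring → Set
  Good pos col =
      GeneralPosition pos
    × NonCrossingColouring pos col
    × (∃[ x ] Fan pos col x)

-- Put the apex v at (0, 4^k) and the other 2k vertices P_0, …, P_{2k-1} on the parabola y = x²,
-- at the strictly decreasing abscissae x_n = 4^(k-n) for n < k and x_(k+j) = -2·4^j. The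
-- orientation of (v, P_n, P_m) is (x_m - x_n)(x_n x_m + 4^k), and comparing powers of 2 in the
-- second factor shows that, seen from v, P_m is a clockwise turn of less than π from P_n exactly
-- when m follows n cyclically by fewer than k steps, or m = n - k (relation Clockwise). So the
-- rays vP_0, …, vP_(2k-1) are in clockwise order and the ray opposite to vP_(k+i) comes right
-- after vP_i: v is a balanced fan once vP_i and vP_(k+i) get colour i. A chord P_p P_q takes the
-- colour of the endpoint from which v sees the other one clockwise. The P_n are in convex position
-- in the cyclic order of their indices, so every edge of colour i disjoint from a chord of colour i
-- lies strictly on one side of it, and edges of equal colour never cross.

module Submission where

open import Defs
open import Data.Nat using (ℕ; _≤_)
open import Data.Product using (_×_; ∃-syntax)

open import Data.Product using (_,_; proj₁; proj₂)
open import Data.Sum using (_⊎_; inj₁; inj₂; [_,_]′)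
open import Data.Empty using (⊥; ⊥-elim)
open import Relation.Nullary using (¬_; yes; no)
open import Relation.Binary.PropositionalEquality
open import Relation.Binary.Definitions using (tri<; tri≈; tri>)
open import Function using (_∘_)

module Plane where
  open import Data.Rational using (ℚ; 0ℚ; 1ℚ; _+_; _-_; _*_; -_; _<_; positive; negative)
  import Data.Rational.Properties as ℚ
  open import Relation.Nullary.Decidable.Core using (dec⇒maybe)
  open import Tactic.RingSolver using (solve-∀)
  open import Tactic.RingSolver.Core.AlmostCommutativeRing using (AlmostCommutativeRing; fromCommutativeRing)
  open import Level using (0ℓ)

  private
    ring : AlmostCommutativeRing 0ℓ 0ℓ
    ring = fromCommutativeRing ℚ.+-*-commutativeRing (λ x → dec⇒maybe (0ℚ ℚ.≟ x))

  orient : Point → Point → Point → ℚ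
  orient p q r = cr (q ⊖ p) (r ⊖ p)

  -- The reflective ring solver does not unfold orient or along, so the identities are stated on coordinates.
  orient-along : ∀ p q r s u → orient p q (along r s u) ≡ (1ℚ - u) * orient p q r + u * orient p q s
  orient-along (px , py) (qx , qy) (rx , ry) (sx , sy) = identity px py qx qy rx ry sx sy
    where
    identity : ∀ px py qx qy rx ry sx sy u →
      (qx - px) * ((ry + u * (sy - ry)) - py) - (qy - py) * ((rx + u * (sx - rx)) - px)
        ≡ (1ℚ - u) * ((qx - px) * (ry - py) - (qy - py) * (rx - px))
          + u * ((qx - px) * (sy - py) - (qy - py) * (sx - px))
    identity = solve-∀ ring

  orient-along-self : ∀ p q t → orient p q (along p q t) ≡ 0ℚ
  orient-along-self (px , py) (qx , qy) = identity px py qx qy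
    where
    identity : ∀ px py qx qy t →
      (qx - px) * ((py + t * (qy - py)) - py) - (qy - py) * ((px + t * (qx - px)) - px) ≡ 0ℚ
    identity = solve-∀ ring

  orient-along-pivot : ∀ p q s t → orient p s (along p q t) ≡ t * orient p s q
  orient-along-pivot (px , py) (qx , qy) (sx , sy) = identity px py qx qy sx sy
    where
    identity : ∀ px py qx qy sx sy t →
      (sx - px) * ((py + t * (qy - py)) - py) - (sy - py) * ((px + t * (qx - px)) - px)
        ≡ t * ((sx - px) * (qy - py) - (sy - py) * (qx - px))
    identity = solve-∀ ring

  along-reverse : ∀ p q t → along q p (1ℚ - t) ≡ along p q t
  along-reverse (px , py) (qx , qy) t = cong₂ _,_ (identity px qx t) (identity py qy t)
    where
    identity : ∀ a b t → b + (1ℚ - t) * (a - b) ≡ a + t * (b - a)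
    identity = solve-∀ ring

  cr-negˡ : ∀ a b → cr (neg a) b ≡ cr b a
  cr-negˡ (ax , ay) (bx , by) = identity ax ay bx by
    where
    identity : ∀ ax ay bx by → (- ax) * by - (- ay) * bx ≡ bx * ay - by * ax
    identity = solve-∀ ring

  cr-negʳ : ∀ a b → cr a (neg b) ≡ cr b a
  cr-negʳ (ax , ay) (bx , by) = identity ax ay bx by
    where
    identity : ∀ ax ay bx by → ax * (- by) - ay * (- bx) ≡ bx * ay - by * ax
    identity = solve-∀ ring

  cr-neg-neg : ∀ a b → cr (neg a) (neg b) ≡ cr a b
  cr-neg-neg (ax , ay) (bx , by) = identity ax ay bx by
    where
    identity : ∀ ax ay bx by → (- ax) * (- by) - (- ay) * (- bx) ≡ ax * by - ay * bx
    identity = solve-∀ ring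

  private
    0<1-t : ∀ {t} → t < 1ℚ → 0ℚ < 1ℚ - t
    0<1-t {t} t<1 = subst (_< 1ℚ - t) (ℚ.+-inverseʳ t) (ℚ.+-monoˡ-< (- t) t<1)

    1-t<1 : ∀ {t} → 0ℚ < t → 1ℚ - t < 1ℚ
    1-t<1 {t} 0<t = subst (1ℚ - t <_) (ℚ.+-identityʳ 1ℚ) (ℚ.+-monoʳ-< 1ℚ (ℚ.neg-antimono-< 0<t))

    pos*neg<0 : ∀ {a x} → 0ℚ < a → x < 0ℚ → a * x < 0ℚ
    pos*neg<0 {a} {x} 0<a x<0 =
      ℚ.negative⁻¹ (a * x) {{ℚ.pos*neg⇒neg a {{positive 0<a}} x {{negative x<0}}}}

    pos*pos>0 : ∀ {a x} → 0ℚ < a → 0ℚ < x → 0ℚ < a * x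
    pos*pos>0 {a} {x} 0<a 0<x =
      ℚ.positive⁻¹ (a * x) {{ℚ.pos*pos⇒pos a {{positive 0<a}} x {{positive 0<x}}}}

    pos*≡0⇒≡0 : ∀ {a x} → 0ℚ < a → a * x ≡ 0ℚ → x ≡ 0ℚ
    pos*≡0⇒≡0 {a} {x} 0<a ax≡0 with ℚ.<-cmp x 0ℚ
    ... | tri< x<0 _ _ = ⊥-elim (ℚ.<-irrefl ax≡0 (pos*neg<0 0<a x<0))
    ... | tri≈ _ x≡0 _ = x≡0
    ... | tri> _ _ 0<x = ⊥-elim (ℚ.<-irrefl (sym ax≡0) (pos*pos>0 0<a 0<x))

  Cross-sym : ∀ p q r s → Cross p q r s → Cross r s p q
  Cross-sym p q r s (t , u , 0<t , t<1 , 0<u , u<1 , meet) = u , t , 0<u , u<1 , 0<t , t<1 , sym meet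

  Cross-swapˡ : ∀ p q r s → Cross p q r s → Cross q p r s
  Cross-swapˡ p q r s (t , u , 0<t , t<1 , 0<u , u<1 , meet) =
    1ℚ - t , u , 0<1-t t<1 , 1-t<1 0<t , 0<u , u<1 , trans (along-reverse p q t) meet

  Cross-swapʳ : ∀ p q r s → Cross p q r s → Cross p q s r
  Cross-swapʳ p q r s = Cross-sym s r p q ∘ Cross-swapˡ r s p q ∘ Cross-sym p q r s

  sameSide⇒¬Cross : ∀ p q r s → orient p q r < 0ℚ → orient p q s < 0ℚ → ¬ Cross p q r s
  sameSide⇒¬Cross p q r s r<0 s<0 (t , u , _ , _ , 0<u , u<1 , meet) =
    ℚ.<-irrefl on-line below-line
    where
    open ≡-Reasoning
    below-line : (1ℚ - u) * orient p q r + u * orient p q s < 0ℚ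
    below-line = ℚ.+-mono-< {(1ℚ - u) * orient p q r} {0ℚ} {u * orient p q s} {0ℚ}
      (pos*neg<0 (0<1-t u<1) r<0) (pos*neg<0 0<u s<0)
    on-line : (1ℚ - u) * orient p q r + u * orient p q s ≡ 0ℚ
    on-line = begin
      (1ℚ - u) * orient p q r + u * orient p q s ≡⟨ orient-along p q r s u ⟨
      orient p q (along r s u)                   ≡⟨ cong (orient p q) meet ⟨
      orient p q (along p q t)                   ≡⟨ orient-along-self p q t ⟩
      0ℚ                                         ∎

  Cross-shared⇒Collinear : ∀ p q s → Cross p q p s → Collinear p s q
  Cross-shared⇒Collinear p q s (t , u , 0<t , _ , _ , _ , meet) = pos*≡0⇒≡0 0<t (begin
    t * orient p s q          ≡⟨ orient-along-pivot p q s t ⟨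
    orient p s (along p q t)  ≡⟨ cong (orient p s) meet ⟩
    orient p s (along p s u)  ≡⟨ orient-along-self p s u ⟩
    0ℚ                        ∎)
    where open ≡-Reasoning

  nextCW-intro : ∀ {S a b} → cr a b < 0ℚ → (∀ d → S d → cr a d < 0ℚ → cr d b < 0ℚ → ⊥) → NextCW S a b
  nextCW-intro ab<0 gap d d∈S (inj₁ (_ , ad<0 , db<0))         = gap d d∈S ad<0 db<0
  nextCW-intro ab<0 gap d d∈S (inj₂ (inj₁ (0<ab , _)))          = ℚ.<-asym ab<0 0<ab
  nextCW-intro ab<0 gap d d∈S (inj₂ (inj₂ (inj₁ (ab≡0 , _))))   = ℚ.<-irrefl ab≡0 ab<0
  nextCW-intro ab<0 gap d d∈S (inj₂ (inj₂ (inj₂ (ab≡0 , _))))   = ℚ.<-irrefl ab≡0 ab<0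

module NonCrossing (k : ℕ) where
  open import Data.Fin using (_≟_)
  open Plane

  nonCrossingColouring : ∀ {pos col} → GeneralPosition k pos → (∀ a b → col a b ≡ col b a)
    → (∀ a b c d → a ≢ b → a ≢ c → a ≢ d → b ≢ c → b ≢ d → c ≢ d
         → col a b ≡ col c d → ¬ Cross (pos a) (pos b) (pos c) (pos d))
    → NonCrossingColouring k pos col
  nonCrossingColouring {pos} {col} (_ , ¬collinear) col-sym disjoint-¬Cross = col-sym , ¬Cross
    where
    ¬Cross : ∀ a b c d → a ≢ b → c ≢ d → ¬ (a ≡ c × b ≡ d) → ¬ (a ≡ d × b ≡ c)
           → col a b ≡ col c d → ¬ Cross (pos a) (pos b) (pos c) (pos d)
    ¬Cross a b c d a≢b c≢d ≢ac,bd ≢ad,bc same with a ≟ c | a ≟ d | b ≟ c | b ≟ d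
    ... | yes refl | _ | _ | _ =
      ¬collinear a d b c≢d a≢b (λ d≡b → ≢ac,bd (refl , sym d≡b))
      ∘ Cross-shared⇒Collinear (pos a) (pos b) (pos d)
    ... | no a≢c | yes refl | _ | _ =
      ¬collinear a c b a≢c a≢b (λ c≡b → ≢ad,bc (refl , sym c≡b))
      ∘ Cross-shared⇒Collinear (pos a) (pos b) (pos c)
      ∘ Cross-swapʳ (pos a) (pos b) (pos c) (pos a)
    ... | no a≢c | no a≢d | yes refl | _ =
      ¬collinear b d a c≢d (a≢b ∘ sym) (a≢d ∘ sym)
      ∘ Cross-shared⇒Collinear (pos b) (pos a) (pos d)
      ∘ Cross-swapˡ (pos a) (pos b) (pos b) (pos d)
    ... | no a≢c | no a≢d | no b≢c | yes refl =
      ¬collinear b c a b≢c (a≢b ∘ sym) (a≢c ∘ sym)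
      ∘ Cross-shared⇒Collinear (pos b) (pos a) (pos c)
      ∘ Cross-swapʳ (pos b) (pos a) (pos c) (pos b)
      ∘ Cross-swapˡ (pos a) (pos b) (pos c) (pos b)
    ... | no a≢c | no a≢d | no b≢c | no b≢d = disjoint-¬Cross a b c d a≢b a≢c a≢d b≢c b≢d c≢d same

module IntegerPlane where
  open import Data.Integer using (ℤ; +_; -[1+_]; 0ℤ; _+_; _-_; _*_; -_; _<_; +<+; -<+)
  import Data.Integer.Properties as ℤ
  open import Data.Integer.Tactic.RingSolver using (solve-∀)
  open import Data.Nat using (zero; suc; z<s)
  open import Data.Rational as ℚ using (ℚ; 0ℚ; *<*)
  import Data.Rational.Properties as ℚₚ
  open import Data.Rational.Literals using (fromℤ)
  open Plane using (orient)

  Pointℤ : Set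
  Pointℤ = ℤ × ℤ

  _⊖ℤ_ : Pointℤ → Pointℤ → Pointℤ
  (a , b) ⊖ℤ (c , d) = (a - c , b - d)

  crℤ : Pointℤ → Pointℤ → ℤ
  crℤ (ax , ay) (bx , by) = ax * by - ay * bx

  orientℤ : Pointℤ → Pointℤ → Pointℤ → ℤ
  orientℤ p q r = crℤ (q ⊖ℤ p) (r ⊖ℤ p)

  orientℤ-rotate : ∀ p q r → orientℤ p q r ≡ orientℤ q r p
  orientℤ-rotate (px , py) (qx , qy) (rx , ry) = identity px py qx qy rx ry
    where
    identity : ∀ px py qx qy rx ry →
      (qx - px) * (ry - py) - (qy - py) * (rx - px) ≡ (rx - qx) * (py - qy) - (ry - qy) * (px - qx)
    identity = solve-∀

  orientℤ-swap : ∀ p q r → orientℤ p r q ≡ - orientℤ p q r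
  orientℤ-swap (px , py) (qx , qy) (rx , ry) = identity px py qx qy rx ry
    where
    identity : ∀ px py qx qy rx ry →
      (rx - px) * (qy - py) - (ry - py) * (qx - px) ≡ - ((qx - px) * (ry - py) - (qy - py) * (rx - px))
    identity = solve-∀

  parabola : ℤ → Pointℤ
  parabola x = (x , x * x)

  orientℤ-parabola : ∀ x y z → orientℤ (parabola x) (parabola y) (parabola z) ≡ (y - x) * ((z - x) * (z - y))
  orientℤ-parabola = identity
    where
    identity : ∀ x y z → (y - x) * (z * z - x * x) - (y * y - x * x) * (z - x) ≡ (y - x) * ((z - x) * (z - y))
    identity = solve-∀

  orientℤ-axis : ∀ b x y → orientℤ (0ℤ , b) (parabola x) (parabola y) ≡ (y - x) * (x * y + b)
  orientℤ-axis = identity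
    where
    identity : ∀ b x y → (x - 0ℤ) * (y * y - b) - (x * x - b) * (y - 0ℤ) ≡ (y - x) * (x * y + b)
    identity = solve-∀

  neg*pos<0 : ∀ {i j} → i < 0ℤ → 0ℤ < j → i * j < 0ℤ
  neg*pos<0 { -[1+ m ]} {+ suc n}  _ _        = -<+
  neg*pos<0 { -[1+ m ]} {+ zero}   _ (+<+ ())
  neg*pos<0 { -[1+ m ]} { -[1+ n ]} _ ()
  neg*pos<0 {+ m}                  (+<+ ()) _

  neg*neg>0 : ∀ {i j} → i < 0ℤ → j < 0ℤ → 0ℤ < i * j
  neg*neg>0 { -[1+ m ]} { -[1+ n ]} _ _        = +<+ z<s
  neg*neg>0 { -[1+ m ]} {+ n}      _ (+<+ ())
  neg*neg>0 {+ m}                  (+<+ ()) _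

  pos*pos>0 : ∀ {i j} → 0ℤ < i → 0ℤ < j → 0ℤ < i * j
  pos*pos>0 {+ suc m} {+ suc n}  _ _        = +<+ z<s
  pos*pos>0 {+ suc m} {+ zero}   _ (+<+ ())
  pos*pos>0 {+ zero}             (+<+ ()) _

  pos*neg<0 : ∀ {i j} → 0ℤ < i → j < 0ℤ → i * j < 0ℤ
  pos*neg<0 {i} {j} 0<i j<0 = subst (_< 0ℤ) (ℤ.*-comm j i) (neg*pos<0 j<0 0<i)

  <⇒-<0 : ∀ {i j} → i < j → i - j < 0ℤ
  <⇒-<0 {i} {j} i<j = subst (i - j <_) (ℤ.+-inverseʳ j) (ℤ.+-monoˡ-< (- j) i<j)

  <⇒0<- : ∀ {i j} → i < j → 0ℤ < j - i
  <⇒0<- {i} {j} i<j = subst (_< j - i) (ℤ.+-inverseʳ i) (ℤ.+-monoˡ-< (- i) i<j)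

  orientℤ-parabola<0 : ∀ {x y z} → z < y → y < x → orientℤ (parabola x) (parabola y) (parabola z) < 0ℤ
  orientℤ-parabola<0 {x} {y} {z} z<y y<x = subst (_< 0ℤ) (sym (orientℤ-parabola x y z))
    (neg*pos<0 (<⇒-<0 y<x) (neg*neg>0 (<⇒-<0 (ℤ.<-trans z<y y<x)) (<⇒-<0 z<y)))

  fromℤ-+ : ∀ a b → fromℤ a ℚ.+ fromℤ b ≡ fromℤ (a + b)
  fromℤ-+ a b = trans (cong₂ (λ x y → (x + y) ℚ./ 1) (ℤ.*-identityʳ a) (ℤ.*-identityʳ b)) (ℚₚ.↥p/↧p≡p (fromℤ (a + b)))

  fromℤ-* : ∀ a b → fromℤ a ℚ.* fromℤ b ≡ fromℤ (a * b)
  fromℤ-* a b = ℚₚ.↥p/↧p≡p (fromℤ (a * b))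

  fromℤ-neg : ∀ a → ℚ.- fromℤ a ≡ fromℤ (- a)
  fromℤ-neg (+ zero)  = refl
  fromℤ-neg (+ suc n) = refl
  fromℤ-neg -[1+ n ]  = refl

  fromℤ-- : ∀ a b → fromℤ a ℚ.- fromℤ b ≡ fromℤ (a - b)
  fromℤ-- a b = trans (cong (fromℤ a ℚ.+_) (fromℤ-neg b)) (fromℤ-+ a (- b))

  fromℤ-mono-< : ∀ {a b} → a < b → fromℤ a ℚ.< fromℤ b
  fromℤ-mono-< {a} {b} a<b = *<* (subst₂ _<_ (sym (ℤ.*-identityʳ a)) (sym (ℤ.*-identityʳ b)) a<b)

  fromℤ-cancel-< : ∀ {a b} → fromℤ a ℚ.< fromℤ b → a < b
  fromℤ-cancel-< {a} {b} (*<* a<b) = subst₂ _<_ (ℤ.*-identityʳ a) (ℤ.*-identityʳ b) a<b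

  fromℤ-injective : ∀ {a b} → fromℤ a ≡ fromℤ b → a ≡ b
  fromℤ-injective = cong ℚ.↥_

  embed : Pointℤ → Point
  embed (x , y) = (fromℤ x , fromℤ y)

  embed-⊖ : ∀ p q → embed p ⊖ embed q ≡ embed (p ⊖ℤ q)
  embed-⊖ (px , py) (qx , qy) = cong₂ _,_ (fromℤ-- px qx) (fromℤ-- py qy)

  cr-embed : ∀ p q → cr (embed p) (embed q) ≡ fromℤ (crℤ p q)
  cr-embed (px , py) (qx , qy) = trans (cong₂ ℚ._-_ (fromℤ-* px qy) (fromℤ-* py qx)) (fromℤ-- (px * qy) (py * qx))

  orient-embed : ∀ p q r → orient (embed p) (embed q) (embed r) ≡ fromℤ (orientℤ p q r)
  orient-embed p q r = trans (cong₂ cr (embed-⊖ q p) (embed-⊖ r p)) (cr-embed (q ⊖ℤ p) (r ⊖ℤ p))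

  orient-embed<0 : ∀ p q r → orientℤ p q r < 0ℤ → orient (embed p) (embed q) (embed r) ℚ.< 0ℚ
  orient-embed<0 p q r pqr<0 = subst (ℚ._< 0ℚ) (sym (orient-embed p q r)) (fromℤ-mono-< pqr<0)

module CyclicOrder where
  open import Data.Nat using (_<_)
  import Data.Nat.Properties as ℕ

  Cyclic : ℕ → ℕ → ℕ → Set
  Cyclic a b c = (a < b × b < c) ⊎ (b < c × c < a) ⊎ (c < a × a < b)

  cyclic-rotate : ∀ {a b c} → Cyclic a b c → Cyclic b c a
  cyclic-rotate (inj₁ a<b<c)         = inj₂ (inj₂ a<b<c)
  cyclic-rotate (inj₂ (inj₁ b<c<a))  = inj₁ b<c<a
  cyclic-rotate (inj₂ (inj₂ c<a<b))  = inj₂ (inj₁ c<a<b)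

  cyclic-trans : ∀ {a b c d} → Cyclic a b c → Cyclic a c d → Cyclic a b d
  cyclic-trans (inj₁ (a<b , b<c))       (inj₁ (_ , c<d))          = inj₁ (a<b , ℕ.<-trans b<c c<d)
  cyclic-trans (inj₁ (a<b , b<c))       (inj₂ (inj₁ (c<d , d<a))) =
    ⊥-elim (ℕ.<-asym (ℕ.<-trans a<b b<c) (ℕ.<-trans c<d d<a))
  cyclic-trans (inj₁ (a<b , _))         (inj₂ (inj₂ (d<a , _)))   = inj₂ (inj₂ (d<a , a<b))
  cyclic-trans (inj₂ (inj₁ (_ , c<a)))  (inj₁ (a<c , _))          = ⊥-elim (ℕ.<-asym a<c c<a)
  cyclic-trans (inj₂ (inj₁ (b<c , _)))  (inj₂ (inj₁ (c<d , d<a))) = inj₂ (inj₁ (ℕ.<-trans b<c c<d , d<a))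
  cyclic-trans (inj₂ (inj₁ (_ , c<a)))  (inj₂ (inj₂ (_ , a<c)))   = ⊥-elim (ℕ.<-asym a<c c<a)
  cyclic-trans (inj₂ (inj₂ (c<a , _)))  (inj₁ (a<c , _))          = ⊥-elim (ℕ.<-asym a<c c<a)
  cyclic-trans (inj₂ (inj₂ (_ , a<b)))  (inj₂ (inj₁ (_ , d<a)))   = inj₂ (inj₂ (d<a , a<b))
  cyclic-trans (inj₂ (inj₂ (c<a , _)))  (inj₂ (inj₂ (_ , a<c)))   = ⊥-elim (ℕ.<-asym a<c c<a)

  cyclic-total : ∀ {a b c} → a ≢ b → a ≢ c → b ≢ c → Cyclic a b c ⊎ Cyclic a c b
  cyclic-total {a} {b} {c} a≢b a≢c b≢c with ℕ.<-cmp a b | ℕ.<-cmp a c | ℕ.<-cmp b c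
  ... | tri≈ _ a≡b _ | _ | _ = ⊥-elim (a≢b a≡b)
  ... | _ | tri≈ _ a≡c _ | _ = ⊥-elim (a≢c a≡c)
  ... | _ | _ | tri≈ _ b≡c _ = ⊥-elim (b≢c b≡c)
  ... | tri< a<b _ _ | _ | tri< b<c _ _ = inj₁ (inj₁ (a<b , b<c))
  ... | _ | tri< a<c _ _ | tri> _ _ c<b = inj₂ (inj₁ (a<c , c<b))
  ... | tri> _ _ b<a | tri< a<c _ _ | tri< _ _ _ = inj₂ (inj₂ (inj₂ (b<a , a<c)))
  ... | tri< a<b _ _ | tri> _ _ c<a | _ = inj₁ (inj₂ (inj₂ (c<a , a<b)))
  ... | tri> _ _ b<a | tri> _ _ c<a | tri< b<c _ _ = inj₁ (inj₂ (inj₁ (b<c , c<a)))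
  ... | tri> _ _ b<a | tri> _ _ c<a | tri> _ _ c<b = inj₂ (inj₂ (inj₁ (c<b , b<a)))

module RimOrder (k : ℕ) (2≤k : 2 ≤ k) where
  open import Data.Nat using (suc; _<_; _+_; _<?_; _≤?_; s≤s; s≤s⁻¹; z<s)
  import Data.Nat.Properties as ℕ
  open ℕ.≤-Reasoning
  open import Relation.Nullary using (Dec)
  open import Relation.Nullary.Decidable using (_×-dec_; _⊎-dec_)
  open CyclicOrder

  -- The combinatorial shadow of "seen from the apex, rim point m is a clockwise turn of less than π
  -- from rim point n"; at cyclic distance k it holds from n + k to n only.
  Clockwise : ℕ → ℕ → Set
  Clockwise n m = (n < m × m < n + k) ⊎ (m + k ≤ n)

  clockwise? : ∀ n m → Dec (Clockwise n m)
  clockwise? n m = (n <? m ×-dec m <? n + k) ⊎-dec (m + k ≤? n)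

  0<k : 0 < k
  0<k = ℕ.<-trans z<s 2≤k

  private
    n<n+k : ∀ n → n < n + k
    n<n+k n = ℕ.m<m+n n 0<k

  clockwise-connex : ∀ {n m} → n ≢ m → Clockwise n m ⊎ Clockwise m n
  clockwise-connex {n} {m} n≢m with ℕ.<-cmp n m
  ... | tri≈ _ n≡m _ = ⊥-elim (n≢m n≡m)
  ... | tri< n<m _ _ with m <? n + k
  ...   | yes m<n+k = inj₁ (inj₁ (n<m , m<n+k))
  ...   | no  m≮n+k = inj₂ (inj₂ (ℕ.≮⇒≥ m≮n+k))
  clockwise-connex {n} {m} n≢m | tri> _ _ m<n with n <? m + k
  ...   | yes n<m+k = inj₂ (inj₁ (m<n , n<m+k))
  ...   | no  n≮m+k = inj₁ (inj₂ (ℕ.≮⇒≥ n≮m+k))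

  clockwise-asym : ∀ {n m} → Clockwise n m → ¬ Clockwise m n
  clockwise-asym (inj₁ (n<m , _))     (inj₁ (m<n , _))    = ℕ.<-asym n<m m<n
  clockwise-asym (inj₁ (_ , m<n+k))   (inj₂ n+k≤m)        = ℕ.<⇒≱ m<n+k n+k≤m
  clockwise-asym (inj₂ m+k≤n)         (inj₁ (_ , n<m+k))  = ℕ.<⇒≱ n<m+k m+k≤n
  clockwise-asym {n} {m} (inj₂ m+k≤n) (inj₂ n+k≤m)        = ℕ.<-irrefl refl (begin-strict
    n      <⟨ n<n+k n ⟩
    n + k  ≤⟨ n+k≤m ⟩
    m      ≤⟨ ℕ.m≤m+n m k ⟩
    m + k  ≤⟨ m+k≤n ⟩
    n      ∎)

  Antipodal : ℕ → ℕ → Set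
  Antipodal n m = m ≡ n + k ⊎ n ≡ m + k

  antipodal-sym : ∀ {n m} → Antipodal n m → Antipodal m n
  antipodal-sym (inj₁ m≡n+k) = inj₂ m≡n+k
  antipodal-sym (inj₂ n≡m+k) = inj₁ n≡m+k

  antipodal-cyclic : ∀ {s s' e} → Antipodal s s' → s' < k + k → Clockwise s e → e ≢ s' → Cyclic s e s'
  antipodal-cyclic (inj₁ refl) _ (inj₁ s<e<s') _ = inj₁ s<e<s'
  antipodal-cyclic {s} {e = e} (inj₁ refl) s+k<k+k (inj₂ e+k≤s) _ = ⊥-elim (ℕ.<-irrefl refl (begin-strict
    k      ≤⟨ ℕ.m≤n+m k e ⟩
    e + k  ≤⟨ e+k≤s ⟩
    s      <⟨ ℕ.+-cancelʳ-< k s k s+k<k+k ⟩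
    k      ∎))
  antipodal-cyclic {s' = s'} (inj₂ refl) _ (inj₁ (s<e , _)) _ = inj₂ (inj₂ (n<n+k s' , s<e))
  antipodal-cyclic {s' = s'} {e} (inj₂ refl) _ (inj₂ e+k≤s'+k) e≢s' =
    inj₂ (inj₁ (ℕ.≤∧≢⇒< (ℕ.+-cancelʳ-≤ k e s' e+k≤s'+k) e≢s' , n<n+k s'))

  successor-clockwise : ∀ {n n'} → n' ≡ suc n ⊎ (suc n ≡ k + k × n' ≡ 0) → Clockwise n n'
  successor-clockwise {n} (inj₁ refl) =
    inj₁ (ℕ.n<1+n n , subst (_< n + k) (ℕ.+-comm n 1) (ℕ.+-monoʳ-< n 2≤k))
  successor-clockwise {n} (inj₂ (1+n≡k+k , refl)) =
    inj₂ (s≤s⁻¹ (subst (suc k ≤_) (sym 1+n≡k+k) (subst (_≤ k + k) (ℕ.+-comm k 1) (ℕ.+-monoʳ-≤ k 0<k))))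

  successor-gap : ∀ {n n' m} → n' ≡ suc n ⊎ (suc n ≡ k + k × n' ≡ 0) → m < k + k
                → ¬ (Clockwise n m × Clockwise m n')
  successor-gap (inj₁ refl) _ (inj₁ (n<m , _) , inj₁ (m<1+n , _)) = ℕ.<⇒≱ n<m (s≤s⁻¹ m<1+n)
  successor-gap (inj₁ refl) _ (inj₁ (_ , m<n+k) , inj₂ n+k<m)     = ℕ.<-asym m<n+k n+k<m
  successor-gap {n} {m = m} (inj₁ refl) _ (inj₂ m+k≤n , inj₁ (_ , 1+n<m+k)) = ℕ.<-irrefl refl (begin-strict
    m + k  ≤⟨ m+k≤n ⟩
    n      <⟨ ℕ.n<1+n n ⟩
    suc n  <⟨ 1+n<m+k ⟩
    m + k  ∎)
  successor-gap {n} {m = m} (inj₁ refl) _ (inj₂ m+k≤n , inj₂ 1+n+k≤m) = ℕ.<-irrefl refl (begin-strict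
    n          <⟨ s≤s (ℕ.m≤m+n n k) ⟩
    suc n + k  ≤⟨ 1+n+k≤m ⟩
    m          ≤⟨ ℕ.m≤m+n m k ⟩
    m + k      ≤⟨ m+k≤n ⟩
    n          ∎)
  successor-gap (inj₂ (_ , refl)) _ (_ , inj₁ (() , _))
  successor-gap {m = m} (inj₂ (1+n≡k+k , refl)) m<k+k (inj₁ (n<m , _) , _) =
    ℕ.<⇒≱ n<m (s≤s⁻¹ (subst (m <_) (sym 1+n≡k+k) m<k+k))
  successor-gap {n} {m = m} (inj₂ (1+n≡k+k , refl)) _ (inj₂ m+k≤n , inj₂ k≤m) = ℕ.<-irrefl refl (begin-strict
    k + k  ≤⟨ ℕ.+-monoˡ-≤ k k≤m ⟩
    m + k  ≤⟨ m+k≤n ⟩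
    n      <⟨ ℕ.n<1+n n ⟩
    suc n  ≡⟨ 1+n≡k+k ⟩
    k + k  ∎)

  antipode-clockwise : ∀ i → Clockwise (k + i) i
  antipode-clockwise i = inj₂ (ℕ.≤-reflexive (ℕ.+-comm i k))

  antipodes-¬clockwise-to : ∀ {i m} → i < k → ¬ (Clockwise i m × Clockwise (k + i) m)
  antipodes-¬clockwise-to {i} {m} i<k (inj₂ m+k≤i , _) = ℕ.<-irrefl refl (begin-strict
    k      ≤⟨ ℕ.m≤n+m k m ⟩
    m + k  ≤⟨ m+k≤i ⟩
    i      <⟨ i<k ⟩
    k      ∎)
  antipodes-¬clockwise-to {i} {m} _ (inj₁ (_ , m<i+k) , inj₁ (k+i<m , _)) =
    ℕ.<-asym m<i+k (subst (_< m) (ℕ.+-comm k i) k+i<m)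
  antipodes-¬clockwise-to {i} {m} _ (inj₁ (i<m , _) , inj₂ m+k≤k+i) =
    ℕ.<⇒≱ i<m (ℕ.+-cancelʳ-≤ k m i (subst (m + k ≤_) (ℕ.+-comm k i) m+k≤k+i))

  antipodes-¬clockwise-from : ∀ {i m} → m < k + k → ¬ (Clockwise m i × Clockwise m (k + i))
  antipodes-¬clockwise-from {i} {m} m<k+k (_ , inj₂ k+i+k≤m) = ℕ.<-irrefl refl (begin-strict
    k + k      ≤⟨ ℕ.+-monoˡ-≤ k (ℕ.m≤m+n k i) ⟩
    k + i + k  ≤⟨ k+i+k≤m ⟩
    m          <⟨ m<k+k ⟩
    k + k      ∎)
  antipodes-¬clockwise-from {i} {m} _ (inj₁ (m<i , _) , inj₁ (_ , k+i<m+k)) =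
    ℕ.<-asym m<i (ℕ.+-cancelʳ-< k i m (subst (_< m + k) (ℕ.+-comm k i) k+i<m+k))
  antipodes-¬clockwise-from {i} {m} _ (inj₂ i+k≤m , inj₁ (m<k+i , _)) =
    ℕ.<⇒≱ m<k+i (subst (_≤ m) (ℕ.+-comm i k) i+k≤m)

module Configuration (k : ℕ) (2≤k : 2 ≤ k) where
  open import Data.Nat as ℕ using (suc; _∸_; _^_; _<?_; s≤s; z<s; s<s)
  import Data.Nat.Properties as ℕ
  open import Data.Integer using (ℤ; +_; 0ℤ; _+_; _-_; _*_; -_; _<_; +<+)
  import Data.Integer.Properties as ℤ
  open CyclicOrder
  open RimOrder k 2≤k
  open IntegerPlane

  private
    1<2 : 1 ℕ.< 2
    1<2 = s<s z<s

    suc-2*<2*suc : ∀ j → suc (2 ℕ.* j) ℕ.< 2 ℕ.* suc j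
    suc-2*<2*suc j = ℕ.≤-reflexive (sym (ℕ.*-suc 2 j))

  xcoord : ℕ → ℤ
  xcoord n with n <? k
  ... | yes _ = + (2 ^ (2 ℕ.* (k ∸ n)))
  ... | no  _ = - + (2 ^ suc (2 ℕ.* (n ∸ k)))

  xcoord-upper : ∀ {n} → n ℕ.< k → xcoord n ≡ + (2 ^ (2 ℕ.* (k ∸ n)))
  xcoord-upper {n} n<k with n <? k
  ... | yes _   = refl
  ... | no  n≮k = ⊥-elim (n≮k n<k)

  xcoord-lower : ∀ {n} → k ℕ.≤ n → xcoord n ≡ - + (2 ^ suc (2 ℕ.* (n ∸ k)))
  xcoord-lower {n} k≤n with n <? k
  ... | yes n<k = ⊥-elim (ℕ.<⇒≱ n<k k≤n)
  ... | no  _   = refl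

  private
    0<2^ : ∀ e → 0ℤ < + (2 ^ e)
    0<2^ e = +<+ (ℕ.m^n>0 2 e)

    2^-mono : ∀ {e f} → e ℕ.< f → + (2 ^ e) < + (2 ^ f)
    2^-mono e<f = +<+ (ℕ.^-monoʳ-< 2 1<2 e<f)

  xcoord-pos : ∀ {n} → n ℕ.< k → 0ℤ < xcoord n
  xcoord-pos {n} n<k = subst (0ℤ <_) (sym (xcoord-upper n<k)) (0<2^ (2 ℕ.* (k ∸ n)))

  xcoord-neg : ∀ {n} → k ℕ.≤ n → xcoord n < 0ℤ
  xcoord-neg {n} k≤n = subst (_< 0ℤ) (sym (xcoord-lower k≤n)) (ℤ.neg-mono-< (0<2^ (suc (2 ℕ.* (n ∸ k)))))

  xcoord-decreasing : ∀ {n m} → n ℕ.< m → xcoord m < xcoord n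
  xcoord-decreasing {n} {m} n<m with ℕ.<-≤-connex m k | ℕ.<-≤-connex n k
  ... | inj₁ m<k | inj₁ n<k rewrite xcoord-upper m<k | xcoord-upper n<k =
    2^-mono (ℕ.*-monoʳ-< 2 (ℕ.∸-monoʳ-< n<m (ℕ.<⇒≤ m<k)))
  ... | inj₁ m<k | inj₂ k≤n = ⊥-elim (ℕ.<⇒≱ (ℕ.<-trans n<m m<k) k≤n)
  ... | inj₂ k≤m | inj₁ n<k = ℤ.<-trans (xcoord-neg k≤m) (xcoord-pos n<k)
  ... | inj₂ k≤m | inj₂ k≤n rewrite xcoord-lower k≤m | xcoord-lower k≤n =
    ℤ.neg-mono-< (2^-mono (s<s (ℕ.*-monoʳ-< 2 (ℕ.∸-monoˡ-< n<m k≤n))))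

  xcoord-injective : ∀ {n m} → xcoord n ≡ xcoord m → n ≡ m
  xcoord-injective {n} {m} xn≡xm with ℕ.<-cmp n m
  ... | tri< n<m _ _ = ⊥-elim (ℤ.<-irrefl (sym xn≡xm) (xcoord-decreasing n<m))
  ... | tri≈ _ n≡m _ = n≡m
  ... | tri> _ _ m<n = ⊥-elim (ℤ.<-irrefl xn≡xm (xcoord-decreasing m<n))

  xcoord≢0 : ∀ n → xcoord n ≢ 0ℤ
  xcoord≢0 n xn≡0 with ℕ.<-≤-connex n k
  ... | inj₁ n<k = ℤ.<-irrefl (sym xn≡0) (xcoord-pos n<k)
  ... | inj₂ k≤n = ℤ.<-irrefl xn≡0 (xcoord-neg k≤n)

  mixed-exponent : ℕ → ℕ → ℕ
  mixed-exponent n m = 2 ℕ.* (k ∸ n) ℕ.+ suc (2 ℕ.* (m ∸ k))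

  private
    2k-split : ∀ {n} → n ℕ.< k → 2 ℕ.* (k ∸ n) ℕ.+ 2 ℕ.* n ≡ 2 ℕ.* k
    2k-split {n} n<k = trans (sym (ℕ.*-distribˡ-+ 2 (k ∸ n) n)) (cong (2 ℕ.*_) (ℕ.m∸n+n≡m (ℕ.<⇒≤ n<k)))

  mixed-exponent-< : ∀ {n m} → n ℕ.< k → k ℕ.≤ m → m ℕ.< n ℕ.+ k → mixed-exponent n m ℕ.< 2 ℕ.* k
  mixed-exponent-< {n} {m} n<k k≤m m<n+k = begin-strict
      2 ℕ.* (k ∸ n) ℕ.+ suc (2 ℕ.* (m ∸ k))  <⟨ ℕ.+-monoʳ-< (2 ℕ.* (k ∸ n)) (ℕ.<-≤-trans (suc-2*<2*suc (m ∸ k)) (ℕ.*-monoʳ-≤ 2 j<n)) ⟩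
      2 ℕ.* (k ∸ n) ℕ.+ 2 ℕ.* n              ≡⟨ 2k-split n<k ⟩
      2 ℕ.* k                                ∎
    where
    open ℕ.≤-Reasoning
    j<n : m ∸ k ℕ.< n
    j<n = subst (m ∸ k ℕ.<_) (ℕ.m+n∸n≡m n k) (ℕ.∸-monoˡ-< m<n+k k≤m)

  mixed-exponent-> : ∀ {n m} → n ℕ.< k → n ℕ.+ k ℕ.≤ m → 2 ℕ.* k ℕ.< mixed-exponent n m
  mixed-exponent-> {n} {m} n<k n+k≤m = begin-strict
      2 ℕ.* k                                ≡⟨ 2k-split n<k ⟨
      2 ℕ.* (k ∸ n) ℕ.+ 2 ℕ.* n              <⟨ ℕ.+-monoʳ-< (2 ℕ.* (k ∸ n)) (ℕ.n<1+n (2 ℕ.* n)) ⟩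
      2 ℕ.* (k ∸ n) ℕ.+ suc (2 ℕ.* n)        ≤⟨ ℕ.+-monoʳ-≤ (2 ℕ.* (k ∸ n)) (s≤s (ℕ.*-monoʳ-≤ 2 n≤j)) ⟩
      2 ℕ.* (k ∸ n) ℕ.+ suc (2 ℕ.* (m ∸ k))  ∎
    where
    open ℕ.≤-Reasoning
    n≤j : n ℕ.≤ m ∸ k
    n≤j = subst (ℕ._≤ m ∸ k) (ℕ.m+n∸n≡m n k) (ℕ.∸-monoˡ-≤ k n+k≤m)

  apexHeight : ℤ
  apexHeight = + (2 ^ (2 ℕ.* k))

  apexFactor : ℕ → ℕ → ℤ
  apexFactor n m = xcoord n * xcoord m + apexHeight

  apexFactor-comm : ∀ n m → apexFactor n m ≡ apexFactor m n
  apexFactor-comm n m = cong (_+ apexHeight) (ℤ.*-comm (xcoord n) (xcoord m))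

  apexFactor-mixed : ∀ {n m} → n ℕ.< k → k ℕ.≤ m → apexFactor n m ≡ apexHeight - + (2 ^ mixed-exponent n m)
  apexFactor-mixed {n} {m} n<k k≤m = begin
    xcoord n * xcoord m + apexHeight                  ≡⟨ cong₂ (λ x y → x * y + apexHeight) (xcoord-upper n<k) (xcoord-lower k≤m) ⟩
    + (2 ^ a) * - + (2 ^ b) + apexHeight              ≡⟨ cong (_+ apexHeight) (ℤ.neg-distribʳ-* (+ (2 ^ a)) (+ (2 ^ b))) ⟨
    - (+ (2 ^ a) * + (2 ^ b)) + apexHeight            ≡⟨ cong (λ x → - x + apexHeight) (ℤ.pos-* (2 ^ a) (2 ^ b)) ⟨
    - + (2 ^ a ℕ.* 2 ^ b) + apexHeight                ≡⟨ cong (λ e → - + e + apexHeight) (ℕ.^-distribˡ-+-* 2 a b) ⟨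
    - + (2 ^ mixed-exponent n m) + apexHeight         ≡⟨ ℤ.+-comm (- + (2 ^ mixed-exponent n m)) apexHeight ⟩
    apexHeight - + (2 ^ mixed-exponent n m)           ∎
    where
    open ≡-Reasoning
    a b : ℕ
    a = 2 ℕ.* (k ∸ n)
    b = suc (2 ℕ.* (m ∸ k))

  apexFactor-pos : ∀ {n m} → m ℕ.< n ℕ.+ k → n ℕ.< m ℕ.+ k → 0ℤ < apexFactor n m
  apexFactor-pos {n} {m} m<n+k n<m+k with ℕ.<-≤-connex n k | ℕ.<-≤-connex m k
  ... | inj₁ n<k | inj₁ m<k = ℤ.+-mono-< (pos*pos>0 (xcoord-pos n<k) (xcoord-pos m<k)) (0<2^ (2 ℕ.* k))
  ... | inj₂ k≤n | inj₂ k≤m = ℤ.+-mono-< (neg*neg>0 (xcoord-neg k≤n) (xcoord-neg k≤m)) (0<2^ (2 ℕ.* k))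
  ... | inj₁ n<k | inj₂ k≤m =
    subst (0ℤ <_) (sym (apexFactor-mixed n<k k≤m)) (<⇒0<- (2^-mono (mixed-exponent-< n<k k≤m m<n+k)))
  ... | inj₂ k≤n | inj₁ m<k =
    subst (0ℤ <_) (trans (sym (apexFactor-mixed m<k k≤n)) (apexFactor-comm m n)) (<⇒0<- (2^-mono (mixed-exponent-< m<k k≤n n<m+k)))

  apexFactor-neg : ∀ {n m} → m ℕ.< k ℕ.+ k → n ℕ.+ k ℕ.≤ m → apexFactor n m < 0ℤ
  apexFactor-neg {n} {m} m<k+k n+k≤m =
    subst (_< 0ℤ) (sym (apexFactor-mixed n<k k≤m)) (<⇒-<0 (2^-mono (mixed-exponent-> n<k n+k≤m)))
    where
    n<k : n ℕ.< k
    n<k = ℕ.+-cancelʳ-< k n k (ℕ.≤-<-trans n+k≤m m<k+k)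
    k≤m : k ℕ.≤ m
    k≤m = ℕ.≤-trans (ℕ.m≤n+m k n) n+k≤m

  apexℤ : Pointℤ
  apexℤ = (0ℤ , apexHeight)

  rimℤ : ℕ → Pointℤ
  rimℤ n = parabola (xcoord n)

  apex-self : ∀ n → orientℤ apexℤ (rimℤ n) (rimℤ n) ≡ 0ℤ
  apex-self n = trans (orientℤ-axis apexHeight (xcoord n) (xcoord n))
    (trans (cong (_* apexFactor n n) (ℤ.+-inverseʳ (xcoord n))) (ℤ.*-zeroˡ (apexFactor n n)))

  apex-clockwise : ∀ {n m} → n ℕ.< k ℕ.+ k → Clockwise n m → orientℤ apexℤ (rimℤ n) (rimℤ m) < 0ℤ
  apex-clockwise {n} {m} _ (inj₁ (n<m , m<n+k)) = subst (_< 0ℤ) (sym (orientℤ-axis apexHeight (xcoord n) (xcoord m)))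
    (neg*pos<0 (<⇒-<0 (xcoord-decreasing n<m)) (apexFactor-pos m<n+k (ℕ.<-≤-trans n<m (ℕ.m≤m+n m k))))
  apex-clockwise {n} {m} n<k+k (inj₂ m+k≤n) = subst (_< 0ℤ) (sym (orientℤ-axis apexHeight (xcoord n) (xcoord m)))
    (pos*neg<0 (<⇒0<- (xcoord-decreasing m<n)) (subst (_< 0ℤ) (apexFactor-comm m n) (apexFactor-neg n<k+k m+k≤n)))
    where
    m<n : m ℕ.< n
    m<n = ℕ.<-≤-trans (ℕ.m<m+n m 0<k) m+k≤n

  apex-clockwise⁻¹ : ∀ {n m} → n ℕ.< k ℕ.+ k → m ℕ.< k ℕ.+ k
                   → orientℤ apexℤ (rimℤ n) (rimℤ m) < 0ℤ → Clockwise n m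
  apex-clockwise⁻¹ {n} {m} n<k+k m<k+k turn<0 with n ℕ.≟ m
  ... | yes refl = ⊥-elim (ℤ.<-irrefl (apex-self n) turn<0)
  ... | no n≢m with clockwise-connex n≢m
  ...   | inj₁ n↻m = n↻m
  ...   | inj₂ m↻n = ⊥-elim (ℤ.<-asym turn<0 (ℤ.neg-cancel-<
          (subst (_< 0ℤ) (orientℤ-swap apexℤ (rimℤ n) (rimℤ m)) (apex-clockwise m<k+k m↻n))))

  rim-cyclic : ∀ {a b c} → Cyclic a b c → orientℤ (rimℤ a) (rimℤ b) (rimℤ c) < 0ℤ
  rim-cyclic (inj₁ (a<b , b<c)) = orientℤ-parabola<0 (xcoord-decreasing b<c) (xcoord-decreasing a<b)
  rim-cyclic {a} {b} {c} (inj₂ (inj₁ b<c<a)) =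
    subst (_< 0ℤ) (sym (orientℤ-rotate (rimℤ a) (rimℤ b) (rimℤ c))) (rim-cyclic (inj₁ b<c<a))
  rim-cyclic {a} {b} {c} (inj₂ (inj₂ c<a<b)) =
    subst (_< 0ℤ) (orientℤ-rotate (rimℤ c) (rimℤ a) (rimℤ b)) (rim-cyclic (inj₁ c<a<b))

  apex-right : ∀ {s e} → s ℕ.< k ℕ.+ k → Clockwise s e → orientℤ (rimℤ s) (rimℤ e) apexℤ < 0ℤ
  apex-right {s} {e} s<k+k s↻e = subst (_< 0ℤ) (orientℤ-rotate apexℤ (rimℤ s) (rimℤ e)) (apex-clockwise s<k+k s↻e)

  antipodal-right : ∀ {s s' e} → Antipodal s s' → s' ℕ.< k ℕ.+ k → Clockwise s e → e ≢ s'
                → orientℤ (rimℤ s) (rimℤ e) (rimℤ s') < 0ℤ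
  antipodal-right s~s' s'<k+k s↻e e≢s' = rim-cyclic (antipodal-cyclic s~s' s'<k+k s↻e e≢s')

  antipodal-chord-right : ∀ {s s' e e'} → Antipodal s s' → s ℕ.< k ℕ.+ k → s' ℕ.< k ℕ.+ k
                      → Clockwise s e → Clockwise s' e' → e ≢ s' → e' ≢ s
                      → orientℤ (rimℤ s) (rimℤ e) (rimℤ e') < 0ℤ
  antipodal-chord-right s~s' s<k+k s'<k+k s↻e s'↻e' e≢s' e'≢s = rim-cyclic (cyclic-trans
    (antipodal-cyclic s~s' s'<k+k s↻e e≢s')
    (cyclic-rotate (cyclic-rotate (antipodal-cyclic (antipodal-sym s~s') s<k+k s'↻e' e'≢s))))

module NodeDrawing (k : ℕ) (2≤k : 2 ≤ k) where
  open import Data.Nat as ℕ using (_+_)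
  import Data.Nat.Properties as ℕ
  open import Data.Fin as Fin using (Fin; toℕ; splitAt; _↑ˡ_; _↑ʳ_; fromℕ<)
  import Data.Fin.Properties as Fin
  open import Data.Sum using (reduce)
  open import Data.Integer as ℤ using (ℤ; 0ℤ)
  import Data.Integer.Properties as ℤ
  import Data.Rational as ℚ
  open import Function using (id)
  open CyclicOrder
  open RimOrder k 2≤k
  open Configuration k 2≤k
  open IntegerPlane
  open Plane

  data Node : Set where
    apex : Node
    rim  : Fin (k + k) → Node

  pointℤ : Node → Pointℤ
  pointℤ apex    = apexℤ
  pointℤ (rim p) = rimℤ (toℕ p)

  point : Node → Point
  point = embed ∘ pointℤ

  point-injective : ∀ x y → point x ≡ point y → x ≡ y
  point-injective apex    apex    _   = refl
  point-injective apex    (rim q) x≡y = ⊥-elim (xcoord≢0 (toℕ q) (sym (fromℤ-injective (cong proj₁ x≡y))))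
  point-injective (rim p) apex    x≡y = ⊥-elim (xcoord≢0 (toℕ p) (fromℤ-injective (cong proj₁ x≡y)))
  point-injective (rim p) (rim q) x≡y =
    cong rim (Fin.toℕ-injective (xcoord-injective (fromℤ-injective (cong proj₁ x≡y))))

  private
    <0⇒≢0 : ∀ {i} → i ℤ.< 0ℤ → i ≢ 0ℤ
    <0⇒≢0 i<0 i≡0 = ℤ.<-irrefl i≡0 i<0

    swap-≢0 : ∀ a b c → orientℤ a c b ≢ 0ℤ → orientℤ a b c ≢ 0ℤ
    swap-≢0 a b c acb≢0 abc≡0 = acb≢0 (trans (orientℤ-swap a b c) (cong ℤ.-_ abc≡0))

    toℕ-≢ : ∀ {p q : Fin (k + k)} → rim p ≢ rim q → toℕ p ≢ toℕ q
    toℕ-≢ p≢q = p≢q ∘ cong rim ∘ Fin.toℕ-injective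

  apex-orientℤ≢0 : ∀ {p q} → rim p ≢ rim q → orientℤ apexℤ (pointℤ (rim p)) (pointℤ (rim q)) ≢ 0ℤ
  apex-orientℤ≢0 {p} {q} p≢q with clockwise-connex (toℕ-≢ p≢q)
  ... | inj₁ p↻q = <0⇒≢0 (apex-clockwise (Fin.toℕ<n p) p↻q)
  ... | inj₂ q↻p = swap-≢0 apexℤ (pointℤ (rim p)) (pointℤ (rim q)) (<0⇒≢0 (apex-clockwise (Fin.toℕ<n q) q↻p))

  orientℤ≢0 : ∀ {x y z} → x ≢ y → x ≢ z → y ≢ z → orientℤ (pointℤ x) (pointℤ y) (pointℤ z) ≢ 0ℤ
  orientℤ≢0 {apex}  {apex}  x≢y _   _   = ⊥-elim (x≢y refl)
  orientℤ≢0 {apex}  {rim _} {apex} _ x≢z _ = ⊥-elim (x≢z refl)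
  orientℤ≢0 {rim _} {apex}  {apex} _ _ y≢z = ⊥-elim (y≢z refl)
  orientℤ≢0 {apex}  {rim p} {rim q} _ _ y≢z = apex-orientℤ≢0 y≢z
  orientℤ≢0 {rim p} {apex}  {rim q} _ x≢z _ =
    subst (_≢ 0ℤ) (sym (orientℤ-rotate (pointℤ (rim p)) apexℤ (pointℤ (rim q)))) (apex-orientℤ≢0 (x≢z ∘ sym))
  orientℤ≢0 {rim p} {rim q} {apex}  x≢y _ _ =
    subst (_≢ 0ℤ) (orientℤ-rotate apexℤ (pointℤ (rim p)) (pointℤ (rim q))) (apex-orientℤ≢0 x≢y)
  orientℤ≢0 {rim p} {rim q} {rim r} x≢y x≢z y≢z with cyclic-total (toℕ-≢ x≢y) (toℕ-≢ x≢z) (toℕ-≢ y≢z)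
  ... | inj₁ pqr = <0⇒≢0 (rim-cyclic pqr)
  ... | inj₂ prq = swap-≢0 (pointℤ (rim p)) (pointℤ (rim q)) (pointℤ (rim r)) (<0⇒≢0 (rim-cyclic prq))

  ¬collinear : ∀ {x y z} → x ≢ y → x ≢ z → y ≢ z → ¬ Collinear (point x) (point y) (point z)
  ¬collinear {x} {y} {z} x≢y x≢z y≢z collinear =
    orientℤ≢0 x≢y x≢z y≢z (fromℤ-injective (trans (sym (orient-embed (pointℤ x) (pointℤ y) (pointℤ z))) collinear))

  colourOf : Fin (k + k) → Fin k
  colourOf p = reduce (splitAt k p)

  data Half : Fin (k + k) → Set where
    upper : ∀ i → Half (i ↑ˡ k)
    lower : ∀ i → Half (k ↑ʳ i)

  half : ∀ p → Half p
  half p with splitAt k p in split≡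
  ... | inj₁ i = subst Half (Fin.splitAt⁻¹-↑ˡ split≡) (upper i)
  ... | inj₂ i = subst Half (Fin.splitAt⁻¹-↑ʳ split≡) (lower i)

  colourOf-upper : ∀ (i : Fin k) → colourOf (i ↑ˡ k) ≡ i
  colourOf-upper i = cong reduce (Fin.splitAt-↑ˡ k i k)

  colourOf-lower : ∀ (i : Fin k) → colourOf (k ↑ʳ i) ≡ i
  colourOf-lower i = cong reduce (Fin.splitAt-↑ʳ k k i)

  halves-antipodal : ∀ (i : Fin k) → Antipodal (toℕ (i ↑ˡ k)) (toℕ (k ↑ʳ i))
  halves-antipodal i = inj₁ (begin
    toℕ (k ↑ʳ i)    ≡⟨ Fin.toℕ-↑ʳ k i ⟩
    k + toℕ i       ≡⟨ ℕ.+-comm k (toℕ i) ⟩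
    toℕ i + k       ≡⟨ cong (_+ k) (Fin.toℕ-↑ˡ i k) ⟨
    toℕ (i ↑ˡ k) + k ∎)
    where open ≡-Reasoning

  colourOf-antipodal : ∀ {p q} → colourOf p ≡ colourOf q → p ≢ q → Antipodal (toℕ p) (toℕ q)
  colourOf-antipodal {p} {q} same p≢q with half p | half q
  ... | upper i | upper j = ⊥-elim (p≢q (cong (_↑ˡ k) (trans (sym (colourOf-upper i)) (trans same (colourOf-upper j)))))
  ... | lower i | lower j = ⊥-elim (p≢q (cong (k ↑ʳ_) (trans (sym (colourOf-lower i)) (trans same (colourOf-lower j)))))
  ... | upper i | lower j with trans (sym (colourOf-upper i)) (trans same (colourOf-lower j))
  ...   | refl = halves-antipodal i
  colourOf-antipodal same p≢q | lower i | upper j with trans (sym (colourOf-lower i)) (trans same (colourOf-upper j))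
  ...   | refl = antipodal-sym (halves-antipodal i)

  chordStart : Fin (k + k) → Fin (k + k) → Fin (k + k)
  chordStart p q with clockwise? (toℕ p) (toℕ q)
  ... | yes _ = p
  ... | no  _ = q

  chordStart-sym : ∀ p q → chordStart p q ≡ chordStart q p
  chordStart-sym p q with clockwise? (toℕ p) (toℕ q) | clockwise? (toℕ q) (toℕ p)
  ... | yes p↻q | yes q↻p = ⊥-elim (clockwise-asym p↻q q↻p)
  ... | yes _   | no  _   = refl
  ... | no  _   | yes _   = refl
  ... | no p↻̸q  | no q↻̸p with toℕ p ℕ.≟ toℕ q
  ...   | yes p≡q = sym (Fin.toℕ-injective p≡q)
  ...   | no  p≢q = ⊥-elim ([ p↻̸q , q↻̸p ]′ (clockwise-connex p≢q))

  chordStart-clockwise : ∀ {p q} → rim p ≢ rim q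
                       → (chordStart p q ≡ p × Clockwise (toℕ p) (toℕ q)) ⊎ (chordStart p q ≡ q × Clockwise (toℕ q) (toℕ p))
  chordStart-clockwise {p} {q} p≢q with clockwise? (toℕ p) (toℕ q)
  ... | yes p↻q = inj₁ (refl , p↻q)
  ... | no  p↻̸q = inj₂ (refl , [ ⊥-elim ∘ p↻̸q , id ]′ (clockwise-connex (toℕ-≢ p≢q)))

  colour : Node → Node → Fin k
  colour apex    apex    = fromℕ< 0<k  -- a loop is not an edge
  colour apex    (rim q) = colourOf q
  colour (rim p) apex    = colourOf p
  colour (rim p) (rim q) = colourOf (chordStart p q)

  colour-sym : ∀ x y → colour x y ≡ colour y x
  colour-sym apex    apex    = refl
  colour-sym apex    (rim q) = refl
  colour-sym (rim p) apex    = refl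
  colour-sym (rim p) (rim q) = cong colourOf (chordStart-sym p q)

  RightOf : Fin (k + k) → Fin (k + k) → Node → Set
  RightOf s e x = orientℤ (rimℤ (toℕ s)) (rimℤ (toℕ e)) (pointℤ x) ℤ.< 0ℤ

  chord-separates : ∀ {s e z w} → Clockwise (toℕ s) (toℕ e) → z ≢ w
                  → rim s ≢ z → rim s ≢ w → rim e ≢ z → rim e ≢ w → colour z w ≡ colourOf s
                  → RightOf s e z × RightOf s e w
  chord-separates {z = apex}  {apex}  _ z≢w _ _ _ _ _ = ⊥-elim (z≢w refl)
  chord-separates {s} {e} {apex}  {rim r} s↻e _ _ s≢w _ e≢w same =
    apex-right (Fin.toℕ<n s) s↻e ,
    antipodal-right (colourOf-antipodal (sym same) (s≢w ∘ cong rim)) (Fin.toℕ<n r) s↻e (toℕ-≢ e≢w)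
  chord-separates {s} {e} {rim r} {apex}  s↻e _ s≢z _ e≢z _ same =
    antipodal-right (colourOf-antipodal (sym same) (s≢z ∘ cong rim)) (Fin.toℕ<n r) s↻e (toℕ-≢ e≢z) ,
    apex-right (Fin.toℕ<n s) s↻e
  chord-separates {s} {e} {rim r} {rim r'} s↻e z≢w s≢z s≢w e≢z e≢w same with chordStart-clockwise z≢w
  ... | inj₁ (start≡r , r↻r') =
    antipodal-right s~r (Fin.toℕ<n r) s↻e (toℕ-≢ e≢z) ,
    antipodal-chord-right s~r (Fin.toℕ<n s) (Fin.toℕ<n r) s↻e r↻r' (toℕ-≢ e≢z) (toℕ-≢ (s≢w ∘ sym))
    where
    s~r : Antipodal (toℕ s) (toℕ r)
    s~r = colourOf-antipodal (sym (trans (cong colourOf (sym start≡r)) same)) (s≢z ∘ cong rim)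
  ... | inj₂ (start≡r' , r'↻r) =
    antipodal-chord-right s~r' (Fin.toℕ<n s) (Fin.toℕ<n r') s↻e r'↻r (toℕ-≢ e≢w) (toℕ-≢ (s≢z ∘ sym)) ,
    antipodal-right s~r' (Fin.toℕ<n r') s↻e (toℕ-≢ e≢w)
    where
    s~r' : Antipodal (toℕ s) (toℕ r')
    s~r' = colourOf-antipodal (sym (trans (cong colourOf (sym start≡r')) same)) (s≢w ∘ cong rim)

  chord-¬Cross : ∀ {s e z w} → Clockwise (toℕ s) (toℕ e) → z ≢ w
               → rim s ≢ z → rim s ≢ w → rim e ≢ z → rim e ≢ w → colour z w ≡ colourOf s
               → ¬ Cross (point (rim s)) (point (rim e)) (point z) (point w)
  chord-¬Cross {s} {e} {z} {w} s↻e z≢w s≢z s≢w e≢z e≢w same =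
    sameSide⇒¬Cross (point (rim s)) (point (rim e)) (point z) (point w)
      (orient-embed<0 (pointℤ (rim s)) (pointℤ (rim e)) (pointℤ z) (proj₁ separated))
      (orient-embed<0 (pointℤ (rim s)) (pointℤ (rim e)) (pointℤ w) (proj₂ separated))
    where
    separated : RightOf s e z × RightOf s e w
    separated = chord-separates s↻e z≢w s≢z s≢w e≢z e≢w same

  disjoint-¬Cross : ∀ {x y z w} → x ≢ y → x ≢ z → x ≢ w → y ≢ z → y ≢ w → z ≢ w
                  → colour x y ≡ colour z w → ¬ Cross (point x) (point y) (point z) (point w)
  disjoint-¬Cross {rim p} {rim q} {z} {w} x≢y x≢z x≢w y≢z y≢w z≢w same with chordStart-clockwise x≢y
  ... | inj₁ (start≡p , p↻q) =
    chord-¬Cross p↻q z≢w x≢z x≢w y≢z y≢w (trans (sym same) (cong colourOf start≡p))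
  ... | inj₂ (start≡q , q↻p) =
    chord-¬Cross q↻p z≢w y≢z y≢w x≢z x≢w (trans (sym same) (cong colourOf start≡q))
    ∘ Cross-swapˡ (point (rim p)) (point (rim q)) (point z) (point w)
  disjoint-¬Cross {x} {y} {rim p} {rim q} x≢y x≢z x≢w y≢z y≢w z≢w same =
    disjoint-¬Cross z≢w (x≢z ∘ sym) (y≢z ∘ sym) (x≢w ∘ sym) (y≢w ∘ sym) x≢y (sym same)
    ∘ Cross-sym (point x) (point y) (point (rim p)) (point (rim q))
  disjoint-¬Cross {apex} {_}    {apex} {_}    _ x≢z _   _   _   _ _ = ⊥-elim (x≢z refl)
  disjoint-¬Cross {apex} {_}    {_}    {apex} _ _   x≢w _   _   _ _ = ⊥-elim (x≢w refl)
  disjoint-¬Cross {_}    {apex} {apex} {_}    _ _   _   y≢z _   _ _ = ⊥-elim (y≢z refl)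
  disjoint-¬Cross {_}    {apex} {_}    {apex} _ _   _   _   y≢w _ _ = ⊥-elim (y≢w refl)

module GoodDrawing (k : ℕ) (2≤k : 2 ≤ k) (v : V k) where
  open import Data.Nat using (_+_)
  open import Data.Fin as Fin using (Fin; toℕ; punchIn; punchOut; _≟_; _↑ˡ_; _↑ʳ_)
  import Data.Fin.Properties as Fin
  open import Data.Rational as ℚ using (0ℚ)
  open import Data.Rational.Literals using (fromℤ)
  open RimOrder k 2≤k
  open Configuration k 2≤k
  open NodeDrawing k 2≤k
  open NonCrossing k
  open IntegerPlane
  open Plane

  node : V k → Node
  node x with v ≟ x
  ... | yes _   = apex
  ... | no  v≢x = rim (punchOut v≢x)

  vertex : Node → V k
  vertex apex    = v
  vertex (rim p) = punchIn v p

  vertex-node : ∀ x → vertex (node x) ≡ x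
  vertex-node x with v ≟ x
  ... | yes v≡x = v≡x
  ... | no  v≢x = Fin.punchIn-punchOut v≢x

  node-vertex : ∀ x → node (vertex x) ≡ x
  node-vertex apex with v ≟ v
  ... | yes _   = refl
  ... | no  v≢v = ⊥-elim (v≢v refl)
  node-vertex (rim p) with v ≟ punchIn v p
  ... | yes v≡p = ⊥-elim (Fin.punchInᵢ≢i v p (sym v≡p))
  ... | no  _   = cong rim (trans (Fin.punchOut-cong v refl) (Fin.punchOut-punchIn v))

  node-injective : ∀ {x y} → node x ≡ node y → x ≡ y
  node-injective {x} {y} nx≡ny = trans (sym (vertex-node x)) (trans (cong vertex nx≡ny) (vertex-node y))

  node-≢ : ∀ {x y} → x ≢ y → node x ≢ node y
  node-≢ x≢y = x≢y ∘ node-injective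

  pos : Drawing k
  pos = point ∘ node

  col : Colouring k
  col x y = colour (node x) (node y)

  general-position : GeneralPosition k pos
  general-position =
    (λ a b → node-injective ∘ point-injective (node a) (node b)) ,
    (λ a b c a≢b a≢c b≢c → ¬collinear (node-≢ a≢b) (node-≢ a≢c) (node-≢ b≢c))

  non-crossing : NonCrossingColouring k pos col
  non-crossing = nonCrossingColouring general-position (λ a b → colour-sym (node a) (node b))
    (λ a b c d a≢b a≢c a≢d b≢c b≢d c≢d →
      disjoint-¬Cross (node-≢ a≢b) (node-≢ a≢c) (node-≢ a≢d) (node-≢ b≢c) (node-≢ b≢d) (node-≢ c≢d))

  labelling : Labelling k v (vertex ∘ rim)
  labelling =
    (λ j j' → Fin.punchIn-injective v j j') ,
    Fin.punchInᵢ≢i v ,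
    (λ u u≢v → punchOut (u≢v ∘ sym) , Fin.punchIn-punchOut (u≢v ∘ sym))

  ray : Fin (k + k) → Point
  ray p = dir k pos v (vertex (rim p))

  cr-ray : ∀ p q → cr (ray p) (ray q) ≡ fromℤ (orientℤ apexℤ (rimℤ (toℕ p)) (rimℤ (toℕ q)))
  cr-ray p q = trans (cong₂ cr (ray-embed p) (ray-embed q)) (cr-embed (rimℤ (toℕ p) ⊖ℤ apexℤ) (rimℤ (toℕ q) ⊖ℤ apexℤ))
    where
    ray-embed : ∀ p → ray p ≡ embed (rimℤ (toℕ p) ⊖ℤ apexℤ)
    ray-embed p = trans (cong₂ (λ x y → point x ⊖ point y) (node-vertex (rim p)) (node-vertex apex))
                        (embed-⊖ (rimℤ (toℕ p)) apexℤ)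

  ray-clockwise : ∀ {p q} → Clockwise (toℕ p) (toℕ q) → cr (ray p) (ray q) ℚ.< 0ℚ
  ray-clockwise {p} {q} p↻q = subst (ℚ._< 0ℚ) (sym (cr-ray p q)) (fromℤ-mono-< (apex-clockwise (Fin.toℕ<n p) p↻q))

  ray-clockwise⁻¹ : ∀ {p q} → cr (ray p) (ray q) ℚ.< 0ℚ → Clockwise (toℕ p) (toℕ q)
  ray-clockwise⁻¹ {p} {q} pq<0 =
    apex-clockwise⁻¹ (Fin.toℕ<n p) (Fin.toℕ<n q) (fromℤ-cancel-< (subst (ℚ._< 0ℚ) (cr-ray p q) pq<0))

  neighbour-rim : ∀ {u} → u ≢ v → ∃[ p ] u ≡ vertex (rim p)
  neighbour-rim u≢v = punchOut (u≢v ∘ sym) , sym (Fin.punchIn-punchOut (u≢v ∘ sym))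

  clockwise-labelling : ClockwiseLabelling k pos v (vertex ∘ rim)
  clockwise-labelling j j' j→j' = nextCW-intro (ray-clockwise (successor-clockwise j→j')) gap
    where
    gap : ∀ d → NbrRays k pos v d → cr (ray j) d ℚ.< 0ℚ → cr d (ray j') ℚ.< 0ℚ → ⊥
    gap d (u , u≢v , refl) jd<0 dj'<0 with neighbour-rim u≢v
    ... | p , refl = successor-gap j→j' (Fin.toℕ<n p) (ray-clockwise⁻¹ jd<0 , ray-clockwise⁻¹ dj'<0)

  module _ (i : Fin k) where
    private
      I K : Fin (k + k)
      I = i ↑ˡ k
      K = k ↑ʳ i

      K↻I : Clockwise (toℕ K) (toℕ I)
      K↻I rewrite Fin.toℕ-↑ˡ i k | Fin.toℕ-↑ʳ k i = antipode-clockwise (toℕ i)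

      ¬clockwise-to-both : ∀ m → ¬ (Clockwise (toℕ I) m × Clockwise (toℕ K) m)
      ¬clockwise-to-both m rewrite Fin.toℕ-↑ˡ i k | Fin.toℕ-↑ʳ k i = antipodes-¬clockwise-to (Fin.toℕ<n i)

      ¬clockwise-from-both : ∀ (p : Fin (k + k)) → ¬ (Clockwise (toℕ p) (toℕ I) × Clockwise (toℕ p) (toℕ K))
      ¬clockwise-from-both p rewrite Fin.toℕ-↑ˡ i k | Fin.toℕ-↑ʳ k i = antipodes-¬clockwise-from (Fin.toℕ<n p)

    upper-balanced : NextCW (R k pos v) (ray I) (neg (ray K))
    upper-balanced = nextCW-intro (subst (ℚ._< 0ℚ) (sym (cr-negʳ (ray I) (ray K))) (ray-clockwise K↻I)) gap
      where
      gap : ∀ d → R k pos v d → cr (ray I) d ℚ.< 0ℚ → cr d (neg (ray K)) ℚ.< 0ℚ → ⊥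
      gap d (u , u≢v , d≡±ray) Id<0 dK<0 with neighbour-rim u≢v | d≡±ray
      ... | p , refl | inj₁ refl = ¬clockwise-to-both (toℕ p)
        (ray-clockwise⁻¹ Id<0 , ray-clockwise⁻¹ (subst (ℚ._< 0ℚ) (cr-negʳ (ray p) (ray K)) dK<0))
      ... | p , refl | inj₂ refl = ¬clockwise-from-both p
        (ray-clockwise⁻¹ (subst (ℚ._< 0ℚ) (cr-negʳ (ray I) (ray p)) Id<0) ,
         ray-clockwise⁻¹ (subst (ℚ._< 0ℚ) (cr-neg-neg (ray p) (ray K)) dK<0))

    lower-balanced : NextCW (R k pos v) (neg (ray I)) (ray K)
    lower-balanced = nextCW-intro (subst (ℚ._< 0ℚ) (sym (cr-negˡ (ray I) (ray K))) (ray-clockwise K↻I)) gap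
      where
      gap : ∀ d → R k pos v d → cr (neg (ray I)) d ℚ.< 0ℚ → cr d (ray K) ℚ.< 0ℚ → ⊥
      gap d (u , u≢v , d≡±ray) Id<0 dK<0 with neighbour-rim u≢v | d≡±ray
      ... | p , refl | inj₁ refl = ¬clockwise-from-both p
        (ray-clockwise⁻¹ (subst (ℚ._< 0ℚ) (cr-negˡ (ray I) (ray p)) Id<0) , ray-clockwise⁻¹ dK<0)
      ... | p , refl | inj₂ refl = ¬clockwise-to-both (toℕ p)
        (ray-clockwise⁻¹ (subst (ℚ._< 0ℚ) (cr-neg-neg (ray I) (ray p)) Id<0) ,
         ray-clockwise⁻¹ (subst (ℚ._< 0ℚ) (cr-negˡ (ray p) (ray K)) dK<0))

    upper-colour : col v (vertex (rim I)) ≡ i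
    upper-colour = trans (cong₂ colour (node-vertex apex) (node-vertex (rim I))) (colourOf-upper i)

    lower-colour : col v (vertex (rim K)) ≡ i
    lower-colour = trans (cong₂ colour (node-vertex apex) (node-vertex (rim K))) (colourOf-lower i)

  fan : Fan k pos col v
  fan = vertex ∘ rim , labelling , clockwise-labelling , ((inj₁ ∘ upper-balanced) , (inj₂ ∘ lower-balanced)) ,
        upper-colour , lower-colour

lemma5 : (k : ℕ) → 2 ≤ k → (v : V k)
       → ∃[ pos ] ∃[ col ] (Good k pos col × Fan k pos col v)
lemma5 k 2≤k v = pos , col , (general-position , non-crossing , v , fan) , fan
  where open GoodDrawing k 2≤k v
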